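{- Let $G$ be a finite simple graph. There exists a natural number $k_0=k_0(G)$ such that for all natural $k\geq k_0$: (i) every $\delta_k$-small set of $G$ is a small set of $G$; (ii) $\varphi^{(1)}(G)\leq\cdots\leq\varphi^{(k_0)}(G)=\varphi^{(k_0+1)}(G)=\cdots=\varphi(G)$, i.e. $\varphi^{(k)}(G)=\varphi(G)$ for all $k\geq k_0$.
   Context: Let $G$ have $n$ vertices and let $d(v)$ denote the degree of $v$. For nonempty $W\subseteq V(G)$ and natural $k$, $D_k(W)=\left(\frac{1}{|W|}\sum_{v\in W}d^k(v)\right)^{1/k}$. $W$ is a small set if $d(v)\leq n-|W|$ for all $v\in W$; $W$ is a $\delta_k$-small set if $D_k(W)\leq n-|W|$. $\varphi(G)$ is the smallest natural number $r$ such that $V(G)$ is a disjoint union of $r$ small sets; $\varphi^{(k)}(G)$ is the smallest natural number $r$ such that $V(G)$ is a disjoint union of $r$ $\delta_k$-small sets. -}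

module Defs where

open import Data.Nat using (ℕ; zero; suc; _+_; _*_; _∸_; _^_; _≤_)
open import Data.Fin using (Fin; _≟_)
open import Data.Bool using (Bool; true; false; if_then_else_)
open import Data.List using (List; map; allFin)
open import Data.Nat.ListAction using (sum)
open import Data.Vec using (lookup; tabulate)
open import Data.Fin.Subset using (Subset; _∈_; ∣_∣; Nonempty)
open import Data.Product using (Σ; _×_)
open import Relation.Nullary.Decidable using (⌊_⌋)
open import Relation.Binary.PropositionalEquality using (_≡_)

record Graph (n : ℕ) : Set where
  field
    adj    : Fin n → Fin n → Bool
    sym    : ∀ u v → adj u v ≡ adj v u
    irrefl : ∀ v → adj v v ≡ false

open Graph public

degree : ∀ {n} → Graph n → Fin n → ℕ
degree {n} G v = sum (map (λ w → if adj G v w then 1 else 0) (allFin n))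

powerSum : ∀ {n} → Graph n → ℕ → Subset n → ℕ
powerSum {n} G k W =
  sum (map (λ v → if lookup W v then degree G v ^ k else 0) (allFin n))

Small : ∀ {n} → Graph n → Subset n → Set
Small {n} G W = ∀ v → v ∈ W → degree G v ≤ n ∸ ∣ W ∣

-- W is δ_k-small: W nonempty and D_k(W) ≤ n - |W|, where
-- D_k(W) = ((1/|W|) Σ_{v∈W} d(v)^k)^{1/k}.  Since n - |W| ≥ 0 and
-- x ↦ x^k is monotone on nonnegative reals (k ≥ 1), this is exactly
-- Σ_{v∈W} d(v)^k ≤ |W| · (n - |W|)^k.
DeltaSmall : ∀ {n} → Graph n → ℕ → Subset n → Set
DeltaSmall {n} G k W =
  Nonempty W × powerSum G k W ≤ ∣ W ∣ * (n ∸ ∣ W ∣) ^ k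

colourClass : ∀ {n r} → (Fin n → Fin r) → Fin r → Subset n
colourClass c i = tabulate (λ v → ⌊ c v ≟ i ⌋)

PartitionInto : ∀ {n} → (Subset n → Set) → ℕ → Set
PartitionInto {n} P r =
  Σ (Fin n → Fin r) λ c → ∀ i → Nonempty (colourClass c i) × P (colourClass c i)

IsLeast : (ℕ → Set) → ℕ → Set
IsLeast Q r = Q r × (∀ m → Q m → r ≤ m)

IsPhi : ∀ {n} → Graph n → ℕ → Set
IsPhi G r = IsLeast (PartitionInto (Small G)) r

IsPhiK : ∀ {n} → Graph n → ℕ → ℕ → Set
IsPhiK G k r = IsLeast (PartitionInto (DeltaSmall G k)) r

module Submission where

-- Everything reduces to inequalities between restricted power sums
-- Σ_{v∈W} d(v)^k: with m = n - |W|, the set W is δ_k-small iff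
-- Σ_{v∈W} d(v)^k ≤ |W|·m^k, and W is small iff d(v) ≤ m for all v ∈ W.
--   * small ⇒ δ_k-small for every k: bound each term by m^k;
--   * δ_{k+1}-small ⇒ δ_k-small for k ≥ 1 (monotonicity of power means):
--     sum the weighted AM–GM inequality (k+1)·m·d^k ≤ k·d^{k+1} + m^{k+1}
--     over W;
--   * δ_k-small ⇒ small once k > n²: a vertex with d(v) ≥ m+1 would give
--     (m+1)^k ≤ Σ_{v∈W} d(v)^k ≤ n·m^k, contradicting n·m^k < (m+1)^k,
--     which follows from Bernoulli's inequality m^k(m+k) ≤ m(m+1)^k.

open import Defs hiding (sym)
open import Data.Nat using (ℕ; zero; suc; _+_; _*_; _∸_; _^_; _≤_; _<_; z≤n; s≤s; _≤?_)
open import Data.Nat.Properties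
open import Data.Nat.ListAction using (sum)
open import Data.Nat.Tactic.RingSolver using (solve-∀)
open import Data.Fin using (Fin; zero; suc)
open import Data.Bool using (true; false; if_then_else_)
open import Data.List using ([]; _∷_; map; allFin; tabulate)
open import Data.List.Properties using (map-tabulate; map-cong)
open import Data.Vec using ([]; _∷_; lookup; here; there)
open import Data.Vec.Properties using (lookup⇒[]=)
open import Data.Fin.Subset using (Subset; _∈_; ∣_∣; Nonempty)
open import Data.Fin.Subset.Properties using (∣p∣≤n)
open import Data.Product using (Σ; _×_; _,_)
open import Data.Sum using (inj₁; inj₂)
open import Data.Empty using (⊥-elim)
open import Function.Bundles using (_⇔_; mk⇔)
open import Relation.Binary.PropositionalEquality
open import Relation.Nullary using (yes; no)

-- AM–GM for two terms: 2dm ≤ d² + m², by writing the larger one as the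
-- smaller one plus t and discarding t².
am-gm : ∀ d m → 2 * d * m ≤ d * d + m * m
am-gm d m with ≤-total d m
... | inj₁ d≤m with m≤n⇒∃[o]m+o≡n d≤m
...   | t , refl = subst (2 * d * (d + t) ≤_) (square-gap d t) (m≤m+n _ (t * t))
  where
  square-gap : ∀ d t → 2 * d * (d + t) + t * t ≡ d * d + (d + t) * (d + t)
  square-gap = solve-∀
am-gm d m | inj₂ m≤d with m≤n⇒∃[o]m+o≡n m≤d
...   | t , refl = subst (2 * (m + t) * m ≤_) (square-gap m t) (m≤m+n _ (t * t))
  where
  square-gap : ∀ m t → 2 * (m + t) * m + t * t ≡ (m + t) * (m + t) + m * m
  square-gap = solve-∀

-- Induction on k:
-- m times the hypothesis for k, plus (k+1)·d^k times 2dm ≤ d² + m², gives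
-- the claim for k+1 after cancelling a common summand.
weighted-am-gm : ∀ k d m → suc k * (m * d ^ k) ≤ k * d ^ suc k + m ^ suc k
weighted-am-gm zero d m = ≤-reflexive (base d m)
  where
  base : ∀ d m → 1 * (m * 1) ≡ 0 * (d * 1) + m * 1
  base = solve-∀
weighted-am-gm (suc k) d m =
  +-cancelˡ-≤ common _ _ (subst₂ _≤_ (lhs k d m p) (rhs k d m p q) combined)
  where
  p q common : ℕ
  p = d ^ k
  q = m ^ k
  common = suc k * (m * m * p) + k * (m * (d * p))
  combined : m * (suc k * (m * p)) + suc k * p * (2 * d * m)
           ≤ m * (k * (d * p) + m * q) + suc k * p * (d * d + m * m)
  combined = +-mono-≤ (*-monoʳ-≤ m (weighted-am-gm k d m))
                      (*-monoʳ-≤ (suc k * p) (am-gm d m))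
  lhs : ∀ k d m p → m * (suc k * (m * p)) + suc k * p * (2 * d * m)
      ≡ (suc k * (m * m * p) + k * (m * (d * p))) + suc (suc k) * (m * (d * p))
  lhs = solve-∀
  rhs : ∀ k d m p q → m * (k * (d * p) + m * q) + suc k * p * (d * d + m * m)
      ≡ (suc k * (m * m * p) + k * (m * (d * p))) + (suc k * (d * (d * p)) + m * (m * q))
  rhs = solve-∀

bernoulli : ∀ k m → m ^ k * (m + k) ≤ m * suc m ^ k
bernoulli zero m = ≤-reflexive (base m)
  where
  base : ∀ m → 1 * (m + 0) ≡ m * 1
  base = solve-∀
bernoulli (suc k) m = begin
  m * m ^ k * (m + suc k)               ≡⟨ split m (m ^ k) k ⟩
  m * (m ^ k * (m + k)) + m * m ^ k     ≤⟨ +-mono-≤ (*-monoʳ-≤ m (bernoulli k m))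
                                                    (*-monoʳ-≤ m (^-monoˡ-≤ k (n≤1+n m))) ⟩
  m * (m * suc m ^ k) + m * suc m ^ k   ≡⟨ merge m (suc m ^ k) ⟩
  m * (suc m * suc m ^ k)               ∎
  where
  open ≤-Reasoning
  split : ∀ m q k → m * q * (m + suc k) ≡ m * (q * (m + k)) + m * q
  split = solve-∀
  merge : ∀ m r → m * (m * r) + m * r ≡ m * (suc m * r)
  merge = solve-∀

-- For m ≤ n and k > n², the power (m+1)^k beats n·m^k: multiplied by m,
-- n·m^{k+1} < m^k·(m + n·m) ≤ m^k·(m + k) ≤ m·(m+1)^k by Bernoulli.
power-gap : ∀ n m k → m ≤ n → n * n < k → n * m ^ k < suc m ^ k
power-gap n zero (suc k) _ _ =
  subst₂ _<_ (sym (*-zeroʳ n)) (sym (^-zeroˡ (suc k))) (s≤s z≤n)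
power-gap n m@(suc _) k m≤n n²<k = *-cancelˡ-< m _ _ (begin-strict
  m * (n * q)          <⟨ m<m+n (m * (n * q)) (≤-trans (m^n>0 m k) (m≤n*m q m)) ⟩
  m * (n * q) + m * q  ≡⟨ regroup m n q ⟩
  q * (m + n * m)      ≤⟨ *-monoʳ-≤ q (+-monoʳ-≤ m nm≤k) ⟩
  q * (m + k)          ≤⟨ bernoulli k m ⟩
  m * suc m ^ k        ∎)
  where
  open ≤-Reasoning
  q : ℕ
  q = m ^ k
  nm≤k : n * m ≤ k
  nm≤k = ≤-trans (*-monoʳ-≤ n m≤n) (<⇒≤ n²<k)
  regroup : ∀ m n q → m * (n * q) + m * q ≡ q * (m + n * m)
  regroup = solve-∀

^-mono-exponent : ∀ k d → 1 ≤ k → d ^ k ≤ d ^ suc k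
^-mono-exponent (suc k) zero    _ = z≤n
^-mono-exponent k       (suc d) _ = m≤n*m (suc d ^ k) (suc d)

sum-map-+ : ∀ {A : Set} (f g : A → ℕ) xs →
            sum (map (λ x → f x + g x) xs) ≡ sum (map f xs) + sum (map g xs)
sum-map-+ f g []       = refl
sum-map-+ f g (x ∷ xs) = begin
  f x + g x + sum (map (λ x → f x + g x) xs)        ≡⟨ cong (f x + g x +_) (sum-map-+ f g xs) ⟩
  f x + g x + (sum (map f xs) + sum (map g xs))     ≡⟨ +-+-interchange (f x) (g x) _ _ ⟩
  f x + sum (map f xs) + (g x + sum (map g xs))     ∎
  where
  open ≡-Reasoning
  +-+-interchange : ∀ a b c d → a + b + (c + d) ≡ a + c + (b + d)
  +-+-interchange = solve-∀

sum-map-*ˡ : ∀ {A : Set} c (f : A → ℕ) xs →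
             sum (map (λ x → c * f x) xs) ≡ c * sum (map f xs)
sum-map-*ˡ c f []       = sym (*-zeroʳ c)
sum-map-*ˡ c f (x ∷ xs) =
  trans (cong (c * f x +_) (sum-map-*ˡ c f xs)) (sym (*-distribˡ-+ c (f x) _))

sum-map-mono : ∀ {A : Set} (f g : A → ℕ) xs → (∀ x → f x ≤ g x) →
               sum (map f xs) ≤ sum (map g xs)
sum-map-mono f g []       f≤g = z≤n
sum-map-mono f g (x ∷ xs) f≤g = +-mono-≤ (f≤g x) (sum-map-mono f g xs f≤g)

restrict : ∀ {n} → Subset n → (Fin n → ℕ) → Fin n → ℕ
restrict W f v = if lookup W v then f v else 0

-- Σ_{v∈W} f(v); the power sum of Defs is sumOver W (λ v → d(v)^k).
sumOver : ∀ {n} → Subset n → (Fin n → ℕ) → ℕ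
sumOver {n} W f = sum (map (restrict W f) (allFin n))

sumOver-∷ : ∀ {n} b (W : Subset n) f →
            sumOver (b ∷ W) f ≡ (if b then f zero else 0) + sumOver W (λ v → f (suc v))
sumOver-∷ {n} b W f = cong ((if b then f zero else 0) +_) (cong sum (begin
  map term (tabulate suc)                ≡⟨ map-tabulate suc term ⟩
  tabulate (λ v → term (suc v))          ≡⟨ map-tabulate (λ v → v) (λ v → term (suc v)) ⟨
  map (λ v → term (suc v)) (allFin n)    ∎))
  where
  open ≡-Reasoning
  term : Fin (suc n) → ℕ
  term = restrict (b ∷ W) f

sumOver-const : ∀ {n} (W : Subset n) c → sumOver W (λ _ → c) ≡ ∣ W ∣ * c
sumOver-const []          c = refl
sumOver-const (true ∷ W)  c = trans (sumOver-∷ true W _) (cong (c +_) (sumOver-const W c))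
sumOver-const (false ∷ W) c = trans (sumOver-∷ false W _) (sumOver-const W c)

term≤sumOver : ∀ {n} (W : Subset n) f v → v ∈ W → f v ≤ sumOver W f
term≤sumOver (true ∷ W) f zero    here =
  subst (f zero ≤_) (sym (sumOver-∷ true W f)) (m≤m+n (f zero) _)
term≤sumOver (b ∷ W)    f (suc v) (there v∈W) =
  subst (f (suc v) ≤_) (sym (sumOver-∷ b W f))
        (≤-trans (term≤sumOver W (λ v → f (suc v)) v v∈W) (m≤n+m _ _))

sumOver-mono : ∀ {n} (W : Subset n) f g → (∀ v → v ∈ W → f v ≤ g v) →
               sumOver W f ≤ sumOver W g
sumOver-mono {n} W f g f≤g = sum-map-mono _ _ (allFin n) termwise
  where
  termwise : ∀ v → restrict W f v ≤ restrict W g v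
  termwise v with lookup W v in eq
  ... | true  = f≤g v (lookup⇒[]= v W eq)
  ... | false = z≤n

sumOver-+ : ∀ {n} (W : Subset n) f g →
            sumOver W (λ v → f v + g v) ≡ sumOver W f + sumOver W g
sumOver-+ {n} W f g = trans (cong sum (map-cong termwise (allFin n)))
                            (sum-map-+ (restrict W f) (restrict W g) (allFin n))
  where
  termwise : ∀ v → restrict W (λ v → f v + g v) v ≡ restrict W f v + restrict W g v
  termwise v with lookup W v
  ... | true  = refl
  ... | false = refl

sumOver-*ˡ : ∀ {n} (W : Subset n) c f → sumOver W (λ v → c * f v) ≡ c * sumOver W f
sumOver-*ˡ {n} W c f = trans (cong sum (map-cong termwise (allFin n)))
                             (sum-map-*ˡ c (restrict W f) (allFin n))
  where
  termwise : ∀ v → restrict W (λ v → c * f v) v ≡ c * restrict W f v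
  termwise v with lookup W v
  ... | true  = refl
  ... | false = sym (*-zeroʳ c)

-- For m > 0, sum the weighted
-- AM–GM inequality over W and cancel (k+1)·m; for m = 0 use d^k ≤ d^{k+1}.
power-mean-mono : ∀ {n} (W : Subset n) (d : Fin n → ℕ) m k → 1 ≤ k →
                  sumOver W (λ v → d v ^ suc k) ≤ ∣ W ∣ * m ^ suc k →
                  sumOver W (λ v → d v ^ k) ≤ ∣ W ∣ * m ^ k
power-mean-mono W d zero (suc k) 1≤k bound =
  ≤-trans (sumOver-mono W _ _ (λ v _ → ^-mono-exponent (suc k) (d v) 1≤k)) bound
power-mean-mono W d m@(suc _) k _ bound = *-cancelˡ-≤ (suc k * m) (begin
  suc k * m * S k                                    ≡⟨ *-assoc (suc k) m (S k) ⟩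
  suc k * (m * S k)                                  ≡⟨ cong (suc k *_) (sumOver-*ˡ W m _) ⟨
  suc k * sumOver W (λ v → m * d v ^ k)              ≡⟨ sumOver-*ˡ W (suc k) _ ⟨
  sumOver W (λ v → suc k * (m * d v ^ k))            ≤⟨ sumOver-mono W _ _ (λ v _ → weighted-am-gm k (d v) m) ⟩
  sumOver W (λ v → k * d v ^ suc k + m ^ suc k)      ≡⟨ sumOver-+ W _ _ ⟩
  sumOver W (λ v → k * d v ^ suc k) + sumOver W (λ _ → m ^ suc k)
                                                     ≡⟨ cong₂ _+_ (sumOver-*ˡ W k _) (sumOver-const W _) ⟩
  k * S (suc k) + ∣ W ∣ * m ^ suc k                  ≤⟨ +-monoˡ-≤ _ (*-monoʳ-≤ k bound) ⟩
  k * (∣ W ∣ * m ^ suc k) + ∣ W ∣ * m ^ suc k        ≡⟨ regroup k ∣ W ∣ m (m ^ k) ⟩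
  suc k * m * (∣ W ∣ * m ^ k)                        ∎)
  where
  open ≤-Reasoning
  S : ℕ → ℕ
  S j = sumOver W (λ v → d v ^ j)
  regroup : ∀ k c m q → k * (c * (m * q)) + c * (m * q) ≡ suc k * m * (c * q)
  regroup = solve-∀

-- If k > n² and the k-th power mean of d over W ⊆ {1..n} is at most m ≤ n,
-- then d(v) ≤ m for every v ∈ W: a single term (m+1)^k would already
-- exceed |W|·m^k ≤ n·m^k.
power-bound⇒pointwise : ∀ {n} (W : Subset n) (d : Fin n → ℕ) m k → m ≤ n → n * n < k →
                        sumOver W (λ v → d v ^ k) ≤ ∣ W ∣ * m ^ k →
                        ∀ v → v ∈ W → d v ≤ m
power-bound⇒pointwise {n} W d m k m≤n n²<k bound v v∈W with d v ≤? m
... | yes dv≤m = dv≤m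
... | no  dv≰m = ⊥-elim (<-irrefl refl (begin-strict
  suc m ^ k                   ≤⟨ ^-monoˡ-≤ k (≰⇒> dv≰m) ⟩
  d v ^ k                     ≤⟨ term≤sumOver W (λ v → d v ^ k) v v∈W ⟩
  sumOver W (λ v → d v ^ k)   ≤⟨ bound ⟩
  ∣ W ∣ * m ^ k               ≤⟨ *-monoˡ-≤ (m ^ k) (∣p∣≤n W) ⟩
  n * m ^ k                   <⟨ power-gap n m k m≤n n²<k ⟩
  suc m ^ k                   ∎))
  where open ≤-Reasoning

small⇒deltaSmall : ∀ {n} (G : Graph n) k (W : Subset n) → Nonempty W → Small G W →
                   DeltaSmall G k W
small⇒deltaSmall {n} G k W nonempty small = nonempty , (begin
  powerSum G k W                      ≤⟨ sumOver-mono W _ _ (λ v v∈W → ^-monoˡ-≤ k (small v v∈W)) ⟩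
  sumOver W (λ _ → (n ∸ ∣ W ∣) ^ k)   ≡⟨ sumOver-const W _ ⟩
  ∣ W ∣ * (n ∸ ∣ W ∣) ^ k             ∎)
  where open ≤-Reasoning

deltaSmall-antitone : ∀ {n} (G : Graph n) k (W : Subset n) → 1 ≤ k →
                      DeltaSmall G (suc k) W → DeltaSmall G k W
deltaSmall-antitone {n} G k W 1≤k (nonempty , bound) =
  nonempty , power-mean-mono W (degree G) (n ∸ ∣ W ∣) k 1≤k bound

deltaSmall⇒small : ∀ {n} (G : Graph n) k (W : Subset n) → n * n < k →
                   DeltaSmall G k W → Small G W
deltaSmall⇒small {n} G k W n²<k (_ , bound) =
  power-bound⇒pointwise W (degree G) (n ∸ ∣ W ∣) k (m∸n≤m n ∣ W ∣) n²<k bound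

partition-map : ∀ {n} {P Q : Subset n → Set} → (∀ W → Nonempty W → P W → Q W) →
                ∀ {r} → PartitionInto P r → PartitionInto Q r
partition-map P⇒Q (colouring , classes) =
  colouring , λ i → let (nonempty , p) = classes i in nonempty , P⇒Q _ nonempty p

isLeast-transfer : ∀ {P Q : ℕ → Set} → (∀ r → P r → Q r) → (∀ r → Q r → P r) →
                   ∀ {r} → IsLeast P r → IsLeast Q r
isLeast-transfer P⇒Q Q⇒P {r} (Pr , least) = P⇒Q r Pr , λ m Qm → least m (Q⇒P m Qm)

theorem2p1 : ∀ {n} (G : Graph n) →
    Σ ℕ λ k₀ → 1 ≤ k₀ ×
      ((∀ k → k₀ ≤ k → ∀ (W : Subset n) → DeltaSmall G k W → Small G W) ×
       ((∀ k → 1 ≤ k → k < k₀ → ∀ r s → IsPhiK G k r → IsPhiK G (suc k) s → r ≤ s) ×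
        (∀ k → k₀ ≤ k → ∀ r → IsPhiK G k r ⇔ IsPhi G r)))
theorem2p1 {n} G = suc (n * n) , s≤s z≤n , stable , monotone , φ-stable
  where
  stable : ∀ k → n * n < k → ∀ (W : Subset n) → DeltaSmall G k W → Small G W
  stable k n²<k W = deltaSmall⇒small G k W n²<k

  -- φ^{(k)} ≤ φ^{(k+1)}: a δ_{k+1}-partition is a δ_k-partition.
  monotone : ∀ k → 1 ≤ k → k < suc (n * n) → ∀ r s →
             IsPhiK G k r → IsPhiK G (suc k) s → r ≤ s
  monotone k 1≤k _ r s (_ , r-least) (s-partition , _) =
    r-least s (partition-map (λ W _ → deltaSmall-antitone G k W 1≤k) s-partition)

  φ-stable : ∀ k → n * n < k → ∀ r → IsPhiK G k r ⇔ IsPhi G r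
  φ-stable k n²<k _ = mk⇔ (isLeast-transfer toSmall fromSmall)
                         (isLeast-transfer fromSmall toSmall)
    where
    toSmall : ∀ r → PartitionInto (DeltaSmall G k) r → PartitionInto (Small G) r
    toSmall _ = partition-map (λ W _ → stable k n²<k W)
    fromSmall : ∀ r → PartitionInto (Small G) r → PartitionInto (DeltaSmall G k) r
    fromSmall _ = partition-map (small⇒deltaSmall G k)
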